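{- If $G$ is a $(3,2)$-critical graph that contains at least three odd cycles, then every two distinct odd cycles of $G$ intersect in more than one vertex.
   Context: Graphs are finite, simple and without isolated vertices. $\chi(G)$ is the chromatic number. ${\rm es}_{\chi}(G)$ is the minimum number of edges of $G$ whose removal results in a spanning subgraph $G_1$ with $\chi(G_1)=\chi(G)-1$. $G$ is $(3,2)$-critical if $\chi(G)=3$, ${\rm es}_{\chi}(G)=2$, and ${\rm es}_{\chi}(G-e)<{\rm es}_{\chi}(G)$ for every edge $e$. Odd cycles are cycle subgraphs of odd length. -}

module Defs where

open import Level using (0ℓ)
open import Data.Nat using (ℕ; zero; suc; _+_; _*_; _∸_; _<_; _≤_)
open import Data.Fin using (Fin; toℕ; inject₁; fromℕ) renaming (zero to fzero; suc to fsuc)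
open import Data.Product using (Σ; ∃; _×_; _,_)
open import Data.Sum using (_⊎_)
open import Data.List using (List; length)
open import Data.List.Membership.Propositional using (_∈_)
open import Data.List.Relation.Unary.All using (All)
open import Data.List.Relation.Unary.Unique.Propositional using (Unique)
open import Relation.Nullary using (¬_)
open import Relation.Binary.PropositionalEquality using (_≡_; _≢_)

record Graph (n : ℕ) : Set₁ where
  field
    Adj   : Fin n → Fin n → Set
    sym   : ∀ {u v} → Adj u v → Adj v u
    irrefl : ∀ {u} → ¬ Adj u u
open Graph public

NoIsolated : ∀ {n} → Graph n → Set
NoIsolated {n} G = ∀ (u : Fin n) → ∃ λ v → Adj G u v

-- An edge {u,v} is stored canonically as the ordered pair (u , v) with u < v.
IsEdge : ∀ {n} → Graph n → Fin n × Fin n → Set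
IsEdge G (u , v) = (toℕ u < toℕ v) × Adj G u v

-- A set of exactly m edges of G: a duplicate-free list of canonical edges of length m.
EdgeSet : ∀ {n} → Graph n → ℕ → Set
EdgeSet {n} G m = Σ (List (Fin n × Fin n)) λ F → All (IsEdge G) F × Unique F × length F ≡ m

deleteEdges : ∀ {n} → Graph n → List (Fin n × Fin n) → Graph n
deleteEdges G F = record
  { Adj = λ u v → Adj G u v × ¬ ((u , v) ∈ F) × ¬ ((v , u) ∈ F)
  ; sym = λ { (a , b , c) → sym G a , c , b }
  ; irrefl = λ { (a , _ , _) → irrefl G a }
  }

deleteEdge : ∀ {n} → Graph n → Fin n × Fin n → Graph n
deleteEdge G e = deleteEdges G (e Data.List.∷ Data.List.[])

Colorable : ∀ {n} → Graph n → ℕ → Set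
Colorable {n} G k = Σ (Fin n → Fin k) λ c → ∀ u v → Adj G u v → c u ≢ c v

ChromaticNumber : ∀ {n} → Graph n → ℕ → Set
ChromaticNumber G zero = Colorable G zero
ChromaticNumber G (suc k) = Colorable G (suc k) × ¬ Colorable G k

-- es_χ(G) = m : m is the minimum number of edges whose removal yields a
-- spanning subgraph with chromatic number χ(G) - 1.
EsChi : ∀ {n} → Graph n → ℕ → Set
EsChi G m = Σ ℕ λ c → ChromaticNumber G c
  × (Σ (EdgeSet G m) λ { (F , _) → ChromaticNumber (deleteEdges G F) (c ∸ 1) })
  × (∀ m' → m' < m → (F : EdgeSet G m') →
       ¬ ChromaticNumber (deleteEdges G (Data.Product.proj₁ F)) (c ∸ 1))

Critical32 : ∀ {n} → Graph n → Set
Critical32 G = ChromaticNumber G 3 × EsChi G 2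
  × (∀ e → IsEdge G e → Σ ℕ λ m → m < 2 × EsChi (deleteEdge G e) m)

-- A cycle subgraph of odd length: distinct vertices C 0, ..., C (len-1),
-- len = 2t+3 ≥ 3, consecutive ones (cyclically) adjacent.
record OddCycle {n} (G : Graph n) : Set where
  field
    t      : ℕ
    vert   : Fin (suc (suc (suc (2 * t)))) → Fin n
    inj    : ∀ i j → vert i ≡ vert j → i ≡ j
    step   : ∀ (i : Fin (suc (suc (2 * t)))) → Adj G (vert (inject₁ i)) (vert (fsuc i))
    close  : Adj G (vert (fromℕ (suc (suc (2 * t))))) (vert fzero)
open OddCycle public

OnCycle : ∀ {n} {G : Graph n} → OddCycle G → Fin n → Set
OnCycle C u = ∃ λ i → vert C i ≡ u

CycleEdge : ∀ {n} {G : Graph n} → OddCycle G → Fin n → Fin n → Set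
CycleEdge C u v =
  (∃ λ i → (vert C (inject₁ i) ≡ u × vert C (fsuc i) ≡ v)
         ⊎ (vert C (inject₁ i) ≡ v × vert C (fsuc i) ≡ u))
  ⊎ ((vert C (fromℕ (suc (suc (2 * t C)))) ≡ u × vert C fzero ≡ v)
    ⊎ (vert C (fromℕ (suc (suc (2 * t C)))) ≡ v × vert C fzero ≡ u))

-- two cycles are the same subgraph iff they have the same edge set
-- (vertex sets are then equal too, as cycles have no isolated vertices)
SameCycle : ∀ {n} {G : Graph n} → OddCycle G → OddCycle G → Set
SameCycle C D = ∀ u v → (CycleEdge C u v → CycleEdge D u v) × (CycleEdge D u v → CycleEdge C u v)

module Submission where

-- For an edge e of G, es_χ(G - e) ≤ 1 together with χ(G - e) ≤ 3 gives
-- an edge f such that G - e - f is bipartite, so every odd cycle of G uses e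
-- or f: every edge has a "partner" edge (critical-has-partners).  Now suppose
-- C and D share at most one vertex.  Then they are edge-disjoint, and by the
-- partner property every edge of G lies on C or on D (covers), and an odd
-- cycle whose edges all lie on C is C itself (contained-is-equal).  Walking
-- around any odd cycle E, its edges can only pass from C to D at a vertex
-- common to C and D; as there is at most one such vertex and the walk is
-- closed, E never switches (cyclic-constant), so E is C or D.  Three pairwise
-- different odd cycles cannot all be C or D, a contradiction.

open import Defs hiding (sym)
open import Data.Bool using (Bool; true; false; if_then_else_) renaming (_≟_ to _≟ᵇ_)
open import Data.Empty using (⊥; ⊥-elim)
open import Data.Fin using (Fin; toℕ; fromℕ; fromℕ<; inject₁; inject≤) renaming (zero to fzero; suc to fsuc)
open import Data.Fin.Properties using (any?; toℕ-injective; toℕ-fromℕ<; toℕ-inject₁; toℕ-fromℕ; toℕ<n; inject≤-injective) renaming (_≟_ to _≟ᶠ_)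
open import Data.List using (List; []; _∷_)
open import Data.List.Membership.Propositional using (_∈_)
open import Data.List.Relation.Unary.Any using (Any; here; there) renaming (any? to anyᴸ?; map to mapᴬ)
open import Data.Nat using (ℕ; zero; suc; _*_; _<_; _≤_; z≤n; s≤s; _≤?_)
open import Data.Nat.DivMod using (_mod_; _%_; m<n⇒m%n≡m; n%n≡0)
open import Data.Nat.Properties using (≤-refl; <-trans; <-≤-trans; <⇒≤; <⇒≢; >⇒≢; ≰⇒>; m≤n⇒m<n∨m≡n; m<n⇒m<1+n; m≤n+m; *-suc; 1+n≢0; suc-injective; <-cmp)
open import Data.Product using (Σ; ∃; _×_; _,_; proj₁; proj₂)
open import Data.Sum using (_⊎_; inj₁; inj₂; map₁)
open import Relation.Binary using (tri<; tri≈; tri>)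
open import Relation.Binary.Definitions using (DecidableEquality)
open import Relation.Binary.PropositionalEquality using (_≡_; _≢_; refl; sym; trans; cong; subst; subst₂; module ≡-Reasoning)
open import Relation.Nullary using (¬_; Dec; yes; no; does)
open import Relation.Nullary.Decidable using (_×-dec_; _⊎-dec_; ¬?)

Joins : ∀ {n} → Fin n → Fin n → Fin n → Fin n → Set
Joins a b u v = (a ≡ u × b ≡ v) ⊎ (a ≡ v × b ≡ u)

_⊆ᶜ_ : ∀ {n} {G : Graph n} → OddCycle G → OddCycle G → Set
X ⊆ᶜ Y = ∀ {u v} → CycleEdge X u v → CycleEdge Y u v

module CycleBasics {n : ℕ} {G : Graph n} where

  CycleEdge-sym : (E : OddCycle G) → ∀ {u v} → CycleEdge E u v → CycleEdge E v u
  CycleEdge-sym E (inj₁ (i , inj₁ ends)) = inj₁ (i , inj₂ ends)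
  CycleEdge-sym E (inj₁ (i , inj₂ ends)) = inj₁ (i , inj₁ ends)
  CycleEdge-sym E (inj₂ (inj₁ ends))     = inj₂ (inj₂ ends)
  CycleEdge-sym E (inj₂ (inj₂ ends))     = inj₂ (inj₁ ends)

  CycleEdge-adj : (E : OddCycle G) → ∀ {u v} → CycleEdge E u v → Adj G u v
  CycleEdge-adj E (inj₁ (i , inj₁ (refl , refl))) = step E i
  CycleEdge-adj E (inj₁ (i , inj₂ (refl , refl))) = Graph.sym G (step E i)
  CycleEdge-adj E (inj₂ (inj₁ (refl , refl)))     = close E
  CycleEdge-adj E (inj₂ (inj₂ (refl , refl)))     = Graph.sym G (close E)

  CycleEdge-ends : (E : OddCycle G) → ∀ {u v} → CycleEdge E u v → OnCycle E u × OnCycle E v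
  CycleEdge-ends E (inj₁ (i , inj₁ (a , b))) = (_ , a) , (_ , b)
  CycleEdge-ends E (inj₁ (i , inj₂ (a , b))) = (_ , b) , (_ , a)
  CycleEdge-ends E (inj₂ (inj₁ (a , b)))     = (_ , a) , (_ , b)
  CycleEdge-ends E (inj₂ (inj₂ (a , b)))     = (_ , b) , (_ , a)

  CycleEdge-joins : (X : OddCycle G) → ∀ {a b u v} → Joins a b u v → CycleEdge X a b → CycleEdge X u v
  CycleEdge-joins X (inj₁ (refl , refl)) e = e
  CycleEdge-joins X (inj₂ (refl , refl)) e = CycleEdge-sym X e

  CycleEdge? : (E : OddCycle G) → ∀ u v → Dec (CycleEdge E u v)
  CycleEdge? E u v =
    any? (λ i → joins? (vert E (inject₁ i)) (vert E (fsuc i))) ⊎-dec joins? (vert E (fromℕ _)) (vert E fzero)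
    where
    joins? : ∀ a b → Dec (Joins a b u v)
    joins? a b = ((a ≟ᶠ u) ×-dec (b ≟ᶠ v)) ⊎-dec ((a ≟ᶠ v) ×-dec (b ≟ᶠ u))

  OnCycle? : (E : OddCycle G) → ∀ u → Dec (OnCycle E u)
  OnCycle? E u = any? (λ i → vert E i ≟ᶠ u)

open CycleBasics

two-colours : (a b c : Fin 2) → a ≢ b → b ≢ c → a ≡ c
two-colours fzero        fzero        _            a≢b _   = ⊥-elim (a≢b refl)
two-colours fzero        (fsuc fzero) fzero        _   _   = refl
two-colours fzero        (fsuc fzero) (fsuc fzero) _   b≢c = ⊥-elim (b≢c refl)
two-colours (fsuc fzero) fzero        fzero        _   b≢c = ⊥-elim (b≢c refl)
two-colours (fsuc fzero) fzero        (fsuc fzero) _   _   = refl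
two-colours (fsuc fzero) (fsuc fzero) _            a≢b _   = ⊥-elim (a≢b refl)

alternating : (h : ℕ → Fin 2) → ∀ t → (∀ k → k < 2 * t → h k ≢ h (suc k)) → h (2 * t) ≡ h 0
alternating h zero    _       = refl
alternating h (suc t) changes = begin
  h (2 * suc t)             ≡⟨ cong h (*-suc 2 t) ⟩
  h (suc (suc (2 * t)))     ≡⟨ sym (two-colours (h (2 * t)) _ _ (changes′ (2 * t) (m≤n+m _ 1))
                                                                (changes′ (suc (2 * t)) ≤-refl)) ⟩
  h (2 * t)                 ≡⟨ alternating h t (λ k k<2t → changes′ k (<-trans k<2t (m≤n+m _ 1))) ⟩
  h 0                       ∎
  where
  open ≡-Reasoning
  changes′ : ∀ k → k < suc (suc (2 * t)) → h k ≢ h (suc k)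
  changes′ k k< = changes k (subst (k <_) (sym (*-suc 2 t)) k<)

-- An odd cycle read as a closed walk: pos k is its vertex number k mod size,
-- so the walk pos 0, pos 1, …, pos last, pos (suc last) = pos 0 traverses
-- every edge of E exactly once.
module Walk {n : ℕ} {G : Graph n} (E : OddCycle G) where

  last size : ℕ
  last = suc (suc (2 * t E))
  size = suc last

  pos : ℕ → Fin n
  pos k = vert E (k mod size)

  pos-index : ∀ k (i : Fin size) → toℕ i ≡ k → pos k ≡ vert E i
  pos-index _ i refl = cong (vert E) (toℕ-injective (trans (toℕ-fromℕ< _) (m<n⇒m%n≡m (toℕ<n i))))

  pos-wrap : pos (suc last) ≡ vert E fzero
  pos-wrap = cong (vert E) (toℕ-injective (trans (toℕ-fromℕ< _) (n%n≡0 size)))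

  pos-injective : ∀ {j k} → j ≤ last → k ≤ last → pos j ≡ pos k → j ≡ k
  pos-injective {j} {k} j≤ k≤ eq = begin
    j               ≡⟨ sym (m<n⇒m%n≡m (s≤s j≤)) ⟩
    j % size        ≡⟨ sym (toℕ-fromℕ< _) ⟩
    toℕ (j mod size) ≡⟨ cong toℕ (inj E _ _ eq) ⟩
    toℕ (k mod size) ≡⟨ toℕ-fromℕ< _ ⟩
    k % size        ≡⟨ m<n⇒m%n≡m (s≤s k≤) ⟩
    k               ∎
    where open ≡-Reasoning

  edge-at : ∀ k → k ≤ last → CycleEdge E (pos k) (pos (suc k))
  edge-at k k≤last with m≤n⇒m<n∨m≡n k≤last
  ... | inj₁ k<last = inj₁ (i , inj₁ (sym (pos-index k (inject₁ i) (trans (toℕ-inject₁ i) (toℕ-fromℕ< k<last)))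
                                    , sym (pos-index (suc k) (fsuc i) (cong suc (toℕ-fromℕ< k<last)))))
    where i = fromℕ< k<last
  ... | inj₂ refl = inj₂ (inj₁ (sym (pos-index last (fromℕ last) (toℕ-fromℕ last)) , sym pos-wrap))

  edge-index : ∀ {u v} → CycleEdge E u v → ∃ λ k → k ≤ last × Joins (pos k) (pos (suc k)) u v
  edge-index (inj₁ (i , ends)) =
    toℕ i , <⇒≤ (toℕ<n i) ,
    subst₂ (λ a b → Joins a b _ _) (sym (pos-index _ (inject₁ i) (toℕ-inject₁ i)))
                                   (sym (pos-index _ (fsuc i) refl)) ends
  edge-index (inj₂ ends) =
    last , ≤-refl ,
    subst₂ (λ a b → Joins a b _ _) (sym (pos-index last (fromℕ last) (toℕ-fromℕ last))) (sym pos-wrap) ends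

  -- Odd cycles are not bipartite: colouring pos 0, pos 1, … alternately
  -- reaches pos last with the colour of pos 0, which is also the colour of
  -- its neighbour pos (suc last).
  odd-cycle-not-bipartite : (col : Fin n → Fin 2) → ¬ (∀ {u v} → CycleEdge E u v → col u ≢ col v)
  odd-cycle-not-bipartite col proper = proper (edge-at last ≤-refl) (trans last≡first (sym (cong col pos-wrap)))
    where
    h : ℕ → Fin 2
    h k = col (pos k)
    changes : ∀ k → k ≤ last → h k ≢ h (suc k)
    changes k k≤ = proper (edge-at k k≤)
    last≡first : h last ≡ h 0
    last≡first = trans (sym (two-colours (h (2 * t E)) _ _ (changes _ (m≤n+m _ 2)) (changes _ (m≤n+m _ 1))))
                       (alternating h (t E) (λ k k< → changes k (<⇒≤ (<-trans k< (m≤n+m _ 1)))))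

module Colourings {n : ℕ} where

  colorable-≤ : (H : Graph n) → ∀ {a b} → Colorable H a → a ≤ b → Colorable H b
  colorable-≤ H (c , proper) a≤b =
    (λ u → inject≤ (c u) a≤b) , λ u v adj eq → proper u v adj (inject≤-injective a≤b a≤b _ _ eq)

  χ-colorable : (H : Graph n) → ∀ k → ChromaticNumber H k → Colorable H k
  χ-colorable H zero    col       = col
  χ-colorable H (suc k) (col , _) = col

  colorable-delete : (H : Graph n) → ∀ F {k} → Colorable H k → Colorable (deleteEdges H F) k
  colorable-delete H F (c , proper) = c , λ u v adj → proper u v (proj₁ adj)

  colorable-delete-none : (H : Graph n) → ∀ {k} → Colorable (deleteEdges H []) k → Colorable H k
  colorable-delete-none H (c , proper) = c , λ u v adj → proper u v (adj , (λ ()) , (λ ()))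

  colorable-delete-twice : (H : Graph n) → ∀ e f {k} →
    Colorable (deleteEdges (deleteEdge H e) (f ∷ [])) k → Colorable (deleteEdges H (e ∷ f ∷ [])) k
  colorable-delete-twice H e f (c , proper) = c , λ u v (adj , uv∉ , vu∉) →
    proper u v ((adj , (λ { (here p) → uv∉ (here p) }) , (λ { (here p) → vu∉ (here p) }))
               , (λ { (here p) → uv∉ (there (here p)) }) , (λ { (here p) → vu∉ (there (here p)) }))

  no-0-colouring : (H : Graph n) → Fin n → ¬ Colorable H 0
  no-0-colouring H w (c , _) with c w
  ... | ()

  -- A 3-colourable graph with es_χ(H) ≤ 1 becomes bipartite after deleting
  -- a suitable single edge: es_χ(H) = 0 is impossible, and for es_χ(H) = 1
  -- the deleted edge lowers χ(H) = k + 1 ≤ 3 to k ≤ 2.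
  one-edge-to-bipartite : (H : Graph n) → Fin n → Colorable H 3 → ∀ {m} → m < 2 → EsChi H m
    → ∃ λ f → Colorable (deleteEdges H (f ∷ [])) 2
  one-edge-to-bipartite H w _ _ (zero , χH , _) = ⊥-elim (no-0-colouring H w χH)
  one-edge-to-bipartite H w _ _ (suc k , (_ , ¬k-col) , (([] , _ , _ , refl) , χH-F) , _) =
    ⊥-elim (¬k-col (colorable-delete-none H (χ-colorable _ k χH-F)))
  one-edge-to-bipartite H w H3 _ (suc k , (_ , ¬k-col) , ((f ∷ [] , _ , _ , refl) , χH-f) , _) with k ≤? 2
  ... | yes k≤2 = f , colorable-≤ (deleteEdges H (f ∷ [])) (χ-colorable _ k χH-f) k≤2
  ... | no  k≰2 = ⊥-elim (¬k-col (colorable-≤ H H3 (≰⇒> k≰2)))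
  one-edge-to-bipartite H w _ (s≤s (s≤s ())) (_ , _ , ((_ ∷ _ ∷ _ , _ , _ , refl) , _) , _)

open Colourings

HasPartners : ∀ {n} → Graph n → Set
HasPartners {n} G = ∀ {u v} → Adj G u v →
  Σ (Fin n × Fin n) λ f → ∀ (E : OddCycle G) → CycleEdge E u v ⊎ CycleEdge E (proj₁ f) (proj₂ f)

module Partners {n : ℕ} {G : Graph n} where

  odd-cycle-meets : (E : OddCycle G) (F : List (Fin n × Fin n)) → Colorable (deleteEdges G F) 2
    → Any (λ e → CycleEdge E (proj₁ e) (proj₂ e)) F
  odd-cycle-meets E F (col , proper) with anyᴸ? (λ e → CycleEdge? E (proj₁ e) (proj₂ e)) F
  ... | yes meets = meets
  ... | no ¬meets = ⊥-elim (Walk.odd-cycle-not-bipartite E col λ {u} {v} e →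
        proper u v (CycleEdge-adj E e , avoids e , avoids (CycleEdge-sym E e)))
    where
    avoids : ∀ {a b} → CycleEdge E a b → ¬ ((a , b) ∈ F)
    avoids e ab∈F = ¬meets (mapᴬ (λ { refl → e }) ab∈F)

  -- The partner of a canonically ordered edge e: by criticality G - e is
  -- 3-colourable with es_χ(G - e) ≤ 1, so G - e - f is bipartite for some f.
  canonical-edge-partner : Critical32 G → Fin n → ∀ {a b} → IsEdge G (a , b) →
    Σ (Fin n × Fin n) λ f → ∀ (E : OddCycle G) → CycleEdge E a b ⊎ CycleEdge E (proj₁ f) (proj₂ f)
  canonical-edge-partner (χG , _ , crit) w {a} {b} ab =
    let (_ , m<2 , es) = crit (a , b) ab
        (f , bipartite) = one-edge-to-bipartite (deleteEdge G (a , b)) w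
                            (colorable-delete G _ (χ-colorable G 3 χG)) m<2 es
    in f , λ E → first-or-second (odd-cycle-meets E _ (colorable-delete-twice G (a , b) f bipartite))
    where
    first-or-second : ∀ {P : Fin n × Fin n → Set} {e f} → Any P (e ∷ f ∷ []) → P e ⊎ P f
    first-or-second (here pe)         = inj₁ pe
    first-or-second (there (here pf)) = inj₂ pf

  critical-has-partners : Critical32 G → Fin n → HasPartners G
  critical-has-partners crit w {u} {v} adj with <-cmp (toℕ u) (toℕ v)
  ... | tri< u<v _ _ = canonical-edge-partner crit w (u<v , adj)
  ... | tri≈ _ u≡v _ = ⊥-elim (Graph.irrefl G (subst (Adj G u) (sym (toℕ-injective u≡v)) adj))
  ... | tri> _ _ v<u with canonical-edge-partner crit w (v<u , Graph.sym G adj)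
  ...   | f , uses = f , λ E → map₁ (CycleEdge-sym E) (uses E)

constant-on : ∀ {A : Set} (f : ℕ → A) {a} b → a ≤ b → (∀ k → a ≤ k → k < b → f k ≡ f (suc k)) → f a ≡ f b
constant-on f zero    z≤n   _     = refl
constant-on f (suc b) a≤1+b steps with m≤n⇒m<n∨m≡n a≤1+b
... | inj₂ refl       = refl
... | inj₁ (s≤s a≤b) =
  trans (constant-on f b a≤b (λ k a≤k k<b → steps k a≤k (m<n⇒m<1+n k<b))) (steps b a≤b ≤-refl)

-- The cyclic word f 0, …, f m (whose last letter is followed by the first)
-- switches at position suc k when f k ≢ f (suc k), and at position 0 when
-- f m ≢ f 0.
data SwitchAt {A : Set} (f : ℕ → A) (m : ℕ) : ℕ → Set where
  inner : ∀ {k} → k < m → f k ≢ f (suc k) → SwitchAt f m (suc k)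
  wrap  : f m ≢ f 0 → SwitchAt f m 0

switch-position : ∀ {A : Set} {f : ℕ → A} {m p} → SwitchAt f m p → p ≤ m
switch-position (inner k<m _) = k<m
switch-position (wrap _)      = z≤n

-- A cyclic word switching at no more than one position is constant: a single
-- switch would leave the first and last letters different, which is a second
-- switch at position 0.
cyclic-constant : ∀ {A : Set} → DecidableEquality A → (f : ℕ → A) (m : ℕ)
  → (∀ {p q} → SwitchAt f m p → SwitchAt f m q → p ≡ q) → ∀ k → k ≤ m → f k ≡ f 0
cyclic-constant {A} _≟_ f m unique k k≤m =
  sym (constant-on f k z≤n (λ j _ j<k → no-switch j (<-≤-trans j<k k≤m)))
  where
  no-switch : ∀ k → k < m → f k ≡ f (suc k)
  no-switch k k<m with f k ≟ f (suc k)
  ... | yes same    = same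
  ... | no  changes = ⊥-elim (1+n≢0 (unique (inner k<m changes) (wrap ends-differ)))
    where
    others : ∀ j → j < m → j ≢ k → f j ≡ f (suc j)
    others j j<m j≢k with f j ≟ f (suc j)
    ... | yes same     = same
    ... | no  changes′ = ⊥-elim (j≢k (suc-injective (unique (inner j<m changes′) (inner k<m changes))))
    ends-differ : f m ≢ f 0
    ends-differ fm≡f0 = changes (begin
      f k       ≡⟨ sym (constant-on f k z≤n (λ j _ j<k → others j (<-trans j<k k<m) (<⇒≢ j<k))) ⟩
      f 0       ≡⟨ sym fm≡f0 ⟩
      f m       ≡⟨ sym (constant-on f m k<m (λ j k<j j<m → others j j<m (>⇒≢ k<j))) ⟩
      f (suc k) ∎)
      where open ≡-Reasoning

EdgeDisjoint : ∀ {n} {G : Graph n} → OddCycle G → OddCycle G → Set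
EdgeDisjoint X Y = ∀ {u v} → CycleEdge X u v → CycleEdge Y u v → ⊥

Common : ∀ {n} {G : Graph n} → OddCycle G → OddCycle G → Fin n → Set
Common C D x = OnCycle C x × OnCycle D x

module WithPartners {n : ℕ} {G : Graph n} (partner : HasPartners G) where

  -- Two edge-disjoint odd cycles cover every edge: an edge on neither would
  -- force its partner onto both.
  covers : (X Y : OddCycle G) → EdgeDisjoint X Y → ∀ {u v} → Adj G u v → CycleEdge X u v ⊎ CycleEdge Y u v
  covers X Y disjoint adj with partner adj
  ... | f , uses with uses X | uses Y
  ...   | inj₁ x  | _       = inj₁ x
  ...   | inj₂ _  | inj₁ y  = inj₂ y
  ...   | inj₂ xf | inj₂ yf = ⊥-elim (disjoint xf yf)

  -- If X has an edge-disjoint odd companion Y, an odd cycle E inside X is X: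
  -- an edge of X missed by E would force its partner onto E ⊆ X and onto Y.
  contained-is-equal : (X Y : OddCycle G) → EdgeDisjoint X Y → (E : OddCycle G) → E ⊆ᶜ X → SameCycle E X
  contained-is-equal X Y disjoint E E⊆X u v = E⊆X , back
    where
    back : CycleEdge X u v → CycleEdge E u v
    back x with partner (CycleEdge-adj X x)
    ... | f , uses with uses E | uses Y
    ...   | inj₁ e  | _       = e
    ...   | inj₂ _  | inj₁ y  = ⊥-elim (disjoint x y)
    ...   | inj₂ ef | inj₂ yf = ⊥-elim (disjoint (E⊆X ef) yf)

  module SharingOneVertex (C D : OddCycle G) (at-most-one : ∀ {x y} → Common C D x → Common C D y → x ≡ y) where

    -- An edge on both cycles would give two distinct common vertices.
    edge-disjoint : EdgeDisjoint C D
    edge-disjoint c d with CycleEdge-ends C c | CycleEdge-ends D d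
    ... | (cu , cv) | (du , dv) =
      Graph.irrefl G (subst (Adj G _) (sym (at-most-one (cu , du) (cv , dv))) (CycleEdge-adj C c))

    sideOf : Bool → OddCycle G
    sideOf b = if b then C else D

    decided-side : ∀ {u v} (onC : Dec (CycleEdge C u v)) → Adj G u v → CycleEdge (sideOf (does onC)) u v
    decided-side (yes c) _   = c
    decided-side (no ¬c) adj with covers C D edge-disjoint adj
    ... | inj₁ c = ⊥-elim (¬c c)
    ... | inj₂ d = d

    different-sides : ∀ {b b′ x} → b ≢ b′ → OnCycle (sideOf b) x → OnCycle (sideOf b′) x → Common C D x
    different-sides {true}  {true}  differ _  _  = ⊥-elim (differ refl)
    different-sides {true}  {false} _      xC xD = xC , xD
    different-sides {false} {true}  _      xD xC = xC , xD
    different-sides {false} {false} differ _  _  = ⊥-elim (differ refl)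

    module OneSide (E : OddCycle G) where
      open Walk E

      onC? : ℕ → Bool
      onC? k = does (CycleEdge? C (pos k) (pos (suc k)))

      side-edge : ∀ k → k ≤ last → CycleEdge (sideOf (onC? k)) (pos k) (pos (suc k))
      side-edge k k≤last = decided-side (CycleEdge? C (pos k) (pos (suc k))) (CycleEdge-adj E (edge-at k k≤last))

      side-ends : ∀ k → k ≤ last → OnCycle (sideOf (onC? k)) (pos k) × OnCycle (sideOf (onC? k)) (pos (suc k))
      side-ends k k≤last = CycleEdge-ends (sideOf (onC? k)) (side-edge k k≤last)

      switch-common : ∀ {p} → SwitchAt onC? last p → Common C D (pos p)
      switch-common (inner {k} k<last switches) =
        different-sides switches (proj₂ (side-ends k (<⇒≤ k<last))) (proj₁ (side-ends (suc k) k<last))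
      switch-common (wrap switches) =
        different-sides switches (subst (OnCycle (sideOf (onC? last))) pos-wrap (proj₂ (side-ends last ≤-refl)))
                                 (proj₁ (side-ends 0 z≤n))

      single-switch : ∀ {p q} → SwitchAt onC? last p → SwitchAt onC? last q → p ≡ q
      single-switch sp sq =
        pos-injective (switch-position sp) (switch-position sq) (at-most-one (switch-common sp) (switch-common sq))

      one-side : E ⊆ᶜ sideOf (onC? 0)
      one-side e with edge-index e
      ... | k , k≤last , joins =
        CycleEdge-joins (sideOf (onC? 0)) joins
          (subst (λ b → CycleEdge (sideOf b) (pos k) (pos (suc k)))
                 (cyclic-constant _≟ᵇ_ onC? last single-switch k k≤last) (side-edge k k≤last))

    inside-side : (E : OddCycle G) → ∀ b → E ⊆ᶜ sideOf b → SameCycle E C ⊎ SameCycle E D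
    inside-side E true  E⊆C = inj₁ (contained-is-equal C D edge-disjoint E E⊆C)
    inside-side E false E⊆D = inj₂ (contained-is-equal D C (λ d c → edge-disjoint c d) E E⊆D)

    is-C-or-D : (E : OddCycle G) → SameCycle E C ⊎ SameCycle E D
    is-C-or-D E = inside-side E _ (OneSide.one-side E)

same-via : ∀ {n} {G : Graph n} (X Y Z : OddCycle G) → SameCycle X Z → SameCycle Y Z → SameCycle X Y
same-via X Y Z X≈Z Y≈Z u v =
  (λ x → proj₂ (Y≈Z u v) (proj₁ (X≈Z u v) x)) , (λ y → proj₂ (X≈Z u v) (proj₁ (Y≈Z u v) y))

no-three-among-two : ∀ {n} {G : Graph n} (C D C₁ C₂ C₃ : OddCycle G)
  → ¬ SameCycle C₁ C₂ → ¬ SameCycle C₁ C₃ → ¬ SameCycle C₂ C₃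
  → SameCycle C₁ C ⊎ SameCycle C₁ D → SameCycle C₂ C ⊎ SameCycle C₂ D → SameCycle C₃ C ⊎ SameCycle C₃ D → ⊥
no-three-among-two C D C₁ C₂ C₃ n12 n13 n23 = among
  where
  among : SameCycle C₁ C ⊎ SameCycle C₁ D → SameCycle C₂ C ⊎ SameCycle C₂ D → SameCycle C₃ C ⊎ SameCycle C₃ D → ⊥
  among (inj₁ a) (inj₁ b) _        = n12 (same-via C₁ C₂ C a b)
  among (inj₂ a) (inj₂ b) _        = n12 (same-via C₁ C₂ D a b)
  among (inj₁ a) (inj₂ _) (inj₁ c) = n13 (same-via C₁ C₃ C a c)
  among (inj₁ _) (inj₂ b) (inj₂ c) = n23 (same-via C₂ C₃ D b c)
  among (inj₂ _) (inj₁ b) (inj₁ c) = n23 (same-via C₂ C₃ C b c)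
  among (inj₂ a) (inj₁ _) (inj₂ c) = n13 (same-via C₁ C₃ D a c)

TwoCommon : ∀ {n} {G : Graph n} → OddCycle G → OddCycle G → Set
TwoCommon {n} C D = Σ (Fin n) λ u → Σ (Fin n) λ v → u ≢ v × OnCycle C u × OnCycle D u × OnCycle C v × OnCycle D v

two-common? : ∀ {n} {G : Graph n} (C D : OddCycle G) → Dec (TwoCommon C D)
two-common? C D = any? λ u → any? λ v →
  ¬? (u ≟ᶠ v) ×-dec OnCycle? C u ×-dec OnCycle? D u ×-dec OnCycle? C v ×-dec OnCycle? D v

at-most-one-common : ∀ {n} {G : Graph n} {C D : OddCycle G} → ¬ TwoCommon C D
  → ∀ {x y} → Common C D x → Common C D y → x ≡ y
at-most-one-common ¬two {x} {y} (xC , xD) (yC , yD) with x ≟ᶠ y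
... | yes x≡y = x≡y
... | no  x≢y = ⊥-elim (¬two (x , y , x≢y , xC , xD , yC , yD))

lemma2p6 : ∀ {n} (G : Graph n) → NoIsolated G → Critical32 G
    → (C₁ C₂ C₃ : OddCycle G)
    → ¬ SameCycle C₁ C₂ → ¬ SameCycle C₁ C₃ → ¬ SameCycle C₂ C₃
    → (C D : OddCycle G) → ¬ SameCycle C D
    → Σ (Fin n) λ u → Σ (Fin n) λ v → u ≢ v × OnCycle C u × OnCycle D u × OnCycle C v × OnCycle D v
lemma2p6 G _ crit C₁ C₂ C₃ n12 n13 n23 C D _ with two-common? C D
... | yes two = two
... | no ¬two = ⊥-elim (no-three-among-two C D C₁ C₂ C₃ n12 n13 n23 (is-C-or-D C₁) (is-C-or-D C₂) (is-C-or-D C₃))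
  where
  open Partners using (critical-has-partners)
  open WithPartners (critical-has-partners crit (vert C fzero))
  open SharingOneVertex C D (at-most-one-common {C = C} {D = D} ¬two)
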